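{- For every synchronized interval $[P,Q]$ (of size $n\ge1$), the labeled tree $\mathrm{R}([P,Q])$ is a decorated tree.
   Context: A Dyck path of size $n$ is a word with $n$ letters $u=(1,1)$ and $n$ letters $d=(1,-1)$ whose walk from $(0,0)$ never goes below the $x$-axis. Tamari order: if $P=A\,d\,U\,C$ where $U=uBd$ is a Dyck path which returns to its starting height only at its end, then $P$ is covered by $A\,U\,d\,C$; the Tamari order $\le$ is the reflexive–transitive closure. For a Dyck path $P$ of size $n$ with up steps at positions $i_1<\dots<i_n$, $\mathrm{Type}(P)=w_1\cdots w_{n-1}$ where $w_k=E$ if the step at position $i_k+1$ is $u$ and $w_k=N$ otherwise. A synchronized interval is a pair $[P,Q]$ of Dyck paths of the same size with $P\le Q$ in Tamari order and $\mathrm{Type}(P)=\mathrm{Type}(Q)$. Rooted plane trees: children of each vertex are linearly ordered; the root has depth $0$; a leaf is a non-root vertex without children, other vertices are internal; the traversal is the depth-first traversal from the root visiting children in order, and the traversal order of leaves is the order in which it meets them. The contour word of a plane tree writes $u$ when an edge is traversed away from the root and $d$ when traversed back; this is a bijection between plane trees with $n$ edges and Dyck paths of size $n$, under which the $i$-th up step corresponds to the $i$-th edge in traversal order, and leaves correspond to up steps immediately followed by a down step. A decorated tree is a rooted plane tree with an integer label $\geq -1$ on each leaf such that: (1) if a leaf $\ell$ has parent of depth $p$, the label of $\ell$ is $<p$; (2) every internal vertex of depth $p>0$ has a descendant leaf with label $\le p-2$; (3) for any vertex $t$ of depth $p$ and any subtree $T'$ rooted at a child of $t$, if a leaf $\ell$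 of $T'$ has label $p$ then every leaf of $T'$ preceding $\ell$ in traversal order has label $\ge p$. The map $\mathrm{R}$: given a synchronized interval $[P,Q]$, let $T$ be the plane tree whose contour word is $Q$. For each leaf $\ell$ of $T$, corresponding to the $i$-th up step of $Q$, consider in $P$ the lowest point $x$ of the maximal run of consecutive down steps following the $i$-th up step of $P$; draw a horizontal ray from $x$ to the left until it first meets a point of $P$ which is the common point of two consecutive up steps. If such a point exists and the lower of these two up steps is the $j$-th up step of $P$, let $e$ be the edge of $T$ corresponding to the $j$-th up step of $Q$ and label $\ell$ with the depth of the endpoint of $e$ closer to the root; if no such point exists, label $\ell$ with $-1$. The resulting labeled tree is $\mathrm{R}([P,Q])$. -}

module Defs where

open import Data.Nat as ℕ using (ℕ; zero; suc; _∸_; _<ᵇ_)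
open import Data.Integer as ℤ using (ℤ; +_; -[1+_])
open import Data.List using (List; []; _∷_; _++_; length; take)
open import Data.List.Relation.Unary.All using (All)
open import Data.List.Relation.Unary.Any using (Any)
open import Data.Maybe using (Maybe; just; nothing)
open import Data.Bool using (Bool; true; false; if_then_else_; _∧_)
open import Data.Product using (_×_; Σ; ∃)
open import Data.Unit using (⊤)
open import Data.Empty using (⊥)
open import Relation.Nullary using (does)
open import Relation.Binary.PropositionalEquality using (_≡_)
open import Relation.Binary.Construct.Closure.ReflexiveTransitive using (Star)

data Step : Set where
  U D : Step          -- U = u = (1,1),  D = d = (1,-1)

Word : Set
Word = List Step

countU : Word → ℕ
countU []       = 0
countU (U ∷ w)  = suc (countU w)
countU (D ∷ w)  = countU w

countD : Word → ℕ
countD []       = 0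
countD (U ∷ w)  = countD w
countD (D ∷ w)  = suc (countD w)

-- height of the walk after its first k steps (the k-th lattice point)
heightAt : Word → ℕ → ℤ
heightAt w k = + countU (take k w) ℤ.- + countD (take k w)

DyckPath : ℕ → Word → Set
DyckPath n w = countU w ≡ n × countD w ≡ n × (∀ k → + 0 ℤ.≤ heightAt w k)

PrimitiveDyck : Word → Set
PrimitiveDyck w = Σ ℕ (λ n → DyckPath n w)
                × (∀ k → 0 ℕ.< k → k ℕ.< length w → + 0 ℤ.< heightAt w k)

data TamariCover : Word → Word → Set where
  cover : (A B C : Word) → PrimitiveDyck (U ∷ B ++ D ∷ []) →
          TamariCover (A ++ D ∷ (U ∷ B ++ D ∷ []) ++ C)
                      (A ++ (U ∷ B ++ D ∷ []) ++ D ∷ C)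

_≤T_ : Word → Word → Set
_≤T_ = Star TamariCover

data Letter : Set where
  E N : Letter

nextLetters : Word → List Letter
nextLetters []            = []
nextLetters (D ∷ w)       = nextLetters w
nextLetters (U ∷ [])      = N ∷ []
nextLetters (U ∷ U ∷ w)   = E ∷ nextLetters (U ∷ w)
nextLetters (U ∷ D ∷ w)   = N ∷ nextLetters (D ∷ w)

-- Type(P) = w_1 ⋯ w_{n-1}  (the last up step is not recorded)
Type : Word → List Letter
Type w = take (countU w ∸ 1) (nextLetters w)

SynchronizedInterval : ℕ → Word → Word → Set
SynchronizedInterval n P Q =
  DyckPath n P × DyckPath n Q × P ≤T Q × Type P ≡ Type Q

data Tree : Set where
  node : List Tree → Tree

mutual
  contour : Tree → Word
  contour (node ts) = contourL ts

  contourL : List Tree → Word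
  contourL []       = []
  contourL (t ∷ ts) = (U ∷ contour t ++ D ∷ []) ++ contourL ts

-- depths of the endpoint closer to the root of every edge, edges listed
-- in traversal order (argument d = depth of the parent vertex)
edgeParentDepthsL : ℕ → List Tree → List ℕ
edgeParentDepthsL d []              = []
edgeParentDepthsL d (node cs ∷ ts) =
  d ∷ (edgeParentDepthsL (suc d) cs ++ edgeParentDepthsL d ts)

edgeParentDepths : Tree → List ℕ
edgeParentDepths (node ts) = edgeParentDepthsL 0 ts

-- Labeled plane trees: non-root childless vertices carry an integer label

data LTree : Set where
  lf : ℤ → LTree
  nd : List LTree → LTree

mutual
  leavesL : List LTree → List ℤ
  leavesL []       = []
  leavesL (t ∷ ts) = leaves t ++ leavesL ts

  leaves : LTree → List ℤ
  leaves (lf x)  = x ∷ []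
  leaves (nd ts) = leavesL ts

-- condition (3) for a subtree T' (given by its list of leaf labels) hanging
-- from a vertex of depth p
Cond3 : ℕ → List ℤ → Set
Cond3 p L = ∀ xs y ys → L ≡ xs ++ y ∷ ys → y ≡ + p → All (λ x → + p ℤ.≤ x) xs

mutual
  -- SubOK p t : t is the subtree rooted at a child of a vertex of depth p
  -- (so the root of t has depth suc p)
  SubOK : ℕ → LTree → Set
  SubOK p (lf x)  = x ℤ.< + p
                  × Cond3 p (x ∷ [])
  SubOK p (nd ts) = Any (λ x → x ℤ.≤ + suc p ℤ.- + 2) (leavesL ts)
                  × Cond3 p (leavesL ts)
                  × SubsOK (suc p) ts

  SubsOK : ℕ → List LTree → Set
  SubsOK p []       = ⊤
  SubsOK p (t ∷ ts) = SubOK p t × SubsOK p ts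

-- the root (depth 0) is a vertex, never a leaf
DecoratedTree : LTree → Set
DecoratedTree (lf _)  = ⊥
DecoratedTree (nd ts) = SubsOK 0 ts

nth : {A : Set} → List A → ℕ → Maybe A
nth []       _       = nothing
nth (x ∷ xs) zero    = just x
nth (x ∷ xs) (suc k) = nth xs k

nthℕ : List ℕ → ℕ → ℕ
nthℕ xs k with nth xs k
... | just x  = x
... | nothing = 0

isU : Maybe Step → Bool
isU (just U) = true
isU _        = false

isD : Maybe Step → Bool
isD (just D) = true
isD _        = false

-- list position (0-based) of the i-th up step (0-based), step s goes from
-- lattice point s to point s+1
upPos : Word → ℕ → Maybe ℕ
upPos []      _       = nothing
upPos (D ∷ w) i       with upPos w i
... | just p  = just (suc p)
... | nothing = nothing
upPos (U ∷ w) zero    = just 0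
upPos (U ∷ w) (suc i) with upPos w i
... | just p  = just (suc p)
... | nothing = nothing

downRun : Word → ℕ → ℕ
downRun []      _       = 0
downRun (U ∷ w) zero    = 0
downRun (D ∷ w) zero    = suc (downRun w 0)
downRun (_ ∷ w) (suc s) = downRun w s

-- lattice point k is the common point of two consecutive up steps
doubleUp : Word → ℕ → Bool
doubleUp w zero    = false
doubleUp w (suc k) = isU (nth w k) ∧ isU (nth w (suc k))

searchLeft : Word → ℤ → ℕ → Maybe ℕ
searchLeft w h zero    = nothing
searchLeft w h (suc k) =
  if doubleUp w (suc k) ∧ does (heightAt w (suc k) ℤ.≟ h)
  then just (suc k) else searchLeft w h k

-- for the i-th up step of P: the index j of the lower up step met by the ray
-- (nothing if the ray meets no such point)
rayIndex : Word → ℕ → Maybe ℕ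
rayIndex P i with upPos P i
... | nothing = nothing
... | just p with suc p ℕ.+ downRun P (suc p)
...   | m with searchLeft P (heightAt P m) (m ∸ 1)
...     | nothing = nothing
...     | just k  = just (countU (take (k ∸ 1) P))

-- label of the leaf whose incoming edge is the i-th edge (= i-th up step)
labelR : Word → Tree → ℕ → ℤ
labelR P T i with rayIndex P i
... | nothing = -[1+ 0 ]
... | just j  = + nthℕ (edgeParentDepths T) j

-- attach labels to leaves; the counter is the traversal index of the edge
-- entering the current vertex, the result also returns the next free index
mutual
  decorateSub : (ℕ → ℤ) → ℕ → Tree → LTree × ℕ
  decorateSub f i (node [])        = lf (f i) Data.Product., suc i
  decorateSub f i (node (c ∷ cs)) with decorateList f (suc i) (c ∷ cs)
  ... | ts Data.Product., k = nd ts Data.Product., k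

  decorateList : (ℕ → ℤ) → ℕ → List Tree → List LTree × ℕ
  decorateList f i []       = [] Data.Product., i
  decorateList f i (c ∷ cs) with decorateSub f i c
  ... | t Data.Product., j with decorateList f j cs
  ...   | ts Data.Product., k = (t ∷ ts) Data.Product., k

decorate : (ℕ → ℤ) → Tree → LTree
decorate f (node ts) with decorateList f 0 ts
... | ts' Data.Product., _ = nd ts'

-- R([P,Q]) where T is the plane tree with contour word Q
R : Word → Tree → LTree
R P T = decorate (labelR P T) T

-- Record a Dyck path by its profile H, the heights at which its up steps start.
-- For the i-th up step of P followed by a down step, the ray of R lands on the
-- last up step j < i whose top is a double-up point at the height H(i+1) of the
-- foot of the descent.  Since H rises by at most one per step, a discrete
-- intermediate value argument gives H(j) < H(c) for all j < c ≤ i+1, and shows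
-- that a ray of a later such step reaching below i is dominated by the ray of i.
-- A Tamari cover A d U C → A U d C only raises the heights on the Dyck factor U,
-- and this preserves such strict minima, so they pass from P to Q.  The profile
-- of Q = contour T is the sequence of parent depths of the edges of T, so edges
-- j+1, …, i+1 hang strictly below the parent of edge j, whose depth is the label
-- of the leaf.  Conditions (1)–(3) follow by comparing this depth with the depths
-- inside the subtree containing the leaf.  Equal types make the leaves of T
-- correspond to the up steps of P followed by a down step.

module Submission where

open import Defs
open import Data.Nat using (ℕ; _≤_)
open import Data.List using (List)
open import Relation.Binary.PropositionalEquality using (_≡_)

open import Data.Nat as ℕ using (zero; suc; _+_; _∸_; _<_; z≤n; s≤s)
import Data.Nat.Properties as ℕP
open import Data.Integer as ℤ using (ℤ; +_; -[1+_])
import Data.Integer.Properties as ℤP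
open import Data.Integer.Tactic.RingSolver using (solve-∀)
open import Data.List using ([]; _∷_; _++_; length; take; map; replicate)
import Data.List.Properties as LP
open import Data.List.Relation.Unary.All as All using (All; []; _∷_)
import Data.List.Relation.Unary.All.Properties as AllP
open import Data.List.Relation.Unary.Any as Any using (Any; here; there)
import Data.List.Relation.Unary.Any.Properties as AnyP
open import Data.Maybe as Maybe using (Maybe; just; nothing; fromMaybe)
import Data.Maybe.Properties as MaybeP
open import Data.Bool using (Bool; true; false; if_then_else_; _∧_)
open import Data.Product using (_×_; ∃-syntax; _,_; proj₁; proj₂)
open import Data.Sum using (_⊎_; inj₁; inj₂)
open import Data.Empty using (⊥-elim)
open import Data.Unit using (tt)
open import Function using (id; _∘_)
open import Relation.Nullary using (¬_; yes; no; does)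
open import Relation.Nullary.Decidable using (_×-dec_; dec-true; dec-false)
open import Relation.Unary using (Decidable)
open import Relation.Binary.PropositionalEquality
open import Relation.Binary.Definitions using (tri<; tri≈; tri>)
open import Relation.Binary.Construct.Closure.ReflexiveTransitive using (ε; _◅_)

nthOr : {A : Set} → A → List A → ℕ → A
nthOr x xs k = fromMaybe x (nth xs k)

module _ {A : Set} where

  nth-++ˡ : ∀ (xs ys : List A) {k} → k < length xs → nth (xs ++ ys) k ≡ nth xs k
  nth-++ˡ (x ∷ xs) ys {zero}  _        = refl
  nth-++ˡ (x ∷ xs) ys {suc k} (s≤s k<) = nth-++ˡ xs ys k<

  nth-++ʳ : ∀ (xs ys : List A) k → nth (xs ++ ys) (length xs + k) ≡ nth ys k
  nth-++ʳ []       ys k = refl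
  nth-++ʳ (x ∷ xs) ys k = nth-++ʳ xs ys k

  nth-beyond : ∀ (xs : List A) {k} → length xs ≤ k → nth xs k ≡ nothing
  nth-beyond []       _         = refl
  nth-beyond (x ∷ xs) (s≤s lx≤) = nth-beyond xs lx≤

  nth-take : ∀ (xs : List A) {m k} → k < m → nth (take m xs) k ≡ nth xs k
  nth-take []       {suc m}         _        = refl
  nth-take (x ∷ xs) {suc m} {zero}  _        = refl
  nth-take (x ∷ xs) {suc m} {suc k} (s≤s k<) = nth-take xs k<

  nthOr-All : ∀ {P : A → Set} {d} (xs : List A) {k} → All P xs → k < length xs → P (nthOr d xs k)
  nthOr-All (x ∷ xs) {zero}  (px ∷ _)   _        = px
  nthOr-All (x ∷ xs) {suc k} (_  ∷ pxs) (s≤s k<) = nthOr-All xs pxs k<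

  nthOr-++ˡ : ∀ {d} (xs ys : List A) {k} → k < length xs → nthOr d (xs ++ ys) k ≡ nthOr d xs k
  nthOr-++ˡ xs ys k< = cong (fromMaybe _) (nth-++ˡ xs ys k<)

  nthOr-++ʳ : ∀ {d} (xs ys : List A) k → nthOr d (xs ++ ys) (length xs + k) ≡ nthOr d ys k
  nthOr-++ʳ xs ys k = cong (fromMaybe _) (nth-++ʳ xs ys k)

  nthOr-map : ∀ {B : Set} (f : A → B) {d d′} (xs : List A) {k} → k < length xs →
              nthOr d′ (map f xs) k ≡ f (nthOr d xs k)
  nthOr-map f (x ∷ xs) {zero}  _        = refl
  nthOr-map f (x ∷ xs) {suc k} (s≤s k<) = nthOr-map f xs k<

  take-length+-++ : ∀ (xs ys : List A) k → take (length xs + k) (xs ++ ys) ≡ xs ++ take k ys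
  take-length+-++ []       ys k = refl
  take-length+-++ (x ∷ xs) ys k = cong (x ∷_) (take-length+-++ xs ys k)

  take-length-++ : ∀ (xs ys : List A) → take (length xs) (xs ++ ys) ≡ xs
  take-length-++ []       ys = refl
  take-length-++ (x ∷ xs) ys = cong (x ∷_) (take-length-++ xs ys)

  take-replicate-++ : ∀ r (x : A) ys → take r (replicate r x ++ ys) ≡ replicate r x
  take-replicate-++ zero    x ys = refl
  take-replicate-++ (suc r) x ys = cong (x ∷_) (take-replicate-++ r x ys)

map-≡-++-∷ : ∀ {A B : Set} (f : A → B) xs {ys z zs} → map f xs ≡ ys ++ z ∷ zs →
             ∃[ xs₁ ] ∃[ x ] ∃[ xs₂ ] xs ≡ xs₁ ++ x ∷ xs₂ × ys ≡ map f xs₁ × z ≡ f x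
map-≡-++-∷ f (x ∷ xs) {[]}     refl = [] , x , xs , refl , refl , refl
map-≡-++-∷ f (x ∷ xs) {y ∷ ys} eq with map-≡-++-∷ f xs (LP.∷-injectiveʳ eq)
... | xs₁ , x′ , xs₂ , refl , refl , refl = x ∷ xs₁ , x′ , xs₂ , refl , cong (_∷ map f xs₁) (sym (LP.∷-injectiveˡ eq)) , refl

nthℕ≡nthOr : ∀ xs k → nthℕ xs k ≡ nthOr 0 xs k
nthℕ≡nthOr xs k with nth xs k
... | just x  = refl
... | nothing = refl

-- Height profiles of words

move : Step → ℤ → ℤ
move U = ℤ.suc
move D = ℤ.pred

endHeight : ℤ → Word → ℤ
endHeight h []      = h
endHeight h (s ∷ w) = endHeight (move s h) w

upHeights : ℤ → Word → List ℤ
upHeights h []      = []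
upHeights h (U ∷ w) = h ∷ upHeights (ℤ.suc h) w
upHeights h (D ∷ w) = upHeights (ℤ.pred h) w

profileFrom : ℤ → Word → List ℤ
profileFrom h w = upHeights h w ++ endHeight h w ∷ []

-- profile w a is the height at which the a-th up step of w starts; the index
-- countU w gives the final height, and larger indices the junk value 0.
profile : Word → ℕ → ℤ
profile w = nthOr (+ 0) (profileFrom (+ 0) w)

endHeight-++ : ∀ h (v v′ : Word) → endHeight h (v ++ v′) ≡ endHeight (endHeight h v) v′
endHeight-++ h []      v′ = refl
endHeight-++ h (s ∷ v) v′ = endHeight-++ (move s h) v v′

upHeights-++ : ∀ h (v v′ : Word) → upHeights h (v ++ v′) ≡ upHeights h v ++ upHeights (endHeight h v) v′
upHeights-++ h []      v′ = refl
upHeights-++ h (U ∷ v) v′ = cong (h ∷_) (upHeights-++ (ℤ.suc h) v v′)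
upHeights-++ h (D ∷ v) v′ = upHeights-++ (ℤ.pred h) v v′

profileFrom-++ : ∀ h (v v′ : Word) → profileFrom h (v ++ v′) ≡ upHeights h v ++ profileFrom (endHeight h v) v′
profileFrom-++ h v v′ rewrite upHeights-++ h v v′ | endHeight-++ h v v′ =
  LP.++-assoc (upHeights h v) _ _

length-upHeights : ∀ h (w : Word) → length (upHeights h w) ≡ countU w
length-upHeights h []      = refl
length-upHeights h (U ∷ w) = cong suc (length-upHeights (ℤ.suc h) w)
length-upHeights h (D ∷ w) = length-upHeights (ℤ.pred h) w

upHeights-suc : ∀ h (w : Word) → upHeights (ℤ.suc h) w ≡ map ℤ.suc (upHeights h w)
upHeights-suc h []      = refl
upHeights-suc h (U ∷ w) = cong (ℤ.suc h ∷_) (upHeights-suc (ℤ.suc h) w)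
upHeights-suc h (D ∷ w) rewrite ℤP.pred-suc h | sym (upHeights-suc (ℤ.pred h) w) | ℤP.suc-pred h = refl

endHeight-counts : ∀ h (w : Word) → endHeight h w ≡ h ℤ.+ (+ countU w ℤ.- + countD w)
endHeight-counts h []      = sym (ℤP.+-identityʳ h)
endHeight-counts h (U ∷ w) = trans (endHeight-counts (ℤ.suc h) w) (shift h (+ countU w) (+ countD w))
  where
  shift : ∀ h u d → (+ 1 ℤ.+ h) ℤ.+ (u ℤ.- d) ≡ h ℤ.+ ((+ 1 ℤ.+ u) ℤ.- d)
  shift = solve-∀
endHeight-counts h (D ∷ w) =
  trans (endHeight-counts (ℤ.pred h) w)
        (trans (shift h (+ countU w) (+ countD w)) (cong (λ z → h ℤ.+ (+ countU w ℤ.+ z)) (sym (-suc (countD w)))))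
  where
  shift : ∀ h u d → (ℤ.- + 1 ℤ.+ h) ℤ.+ (u ℤ.- d) ≡ h ℤ.+ (u ℤ.+ (ℤ.- + 1 ℤ.- d))
  shift = solve-∀
  -- the ring solver sees -[1+ n ] as an atom
  -suc : ∀ n → -[1+ n ] ≡ ℤ.- + 1 ℤ.- + n
  -suc zero    = refl
  -suc (suc n) = refl

heightAt≡endHeight : ∀ (w : Word) k → heightAt w k ≡ endHeight (+ 0) (take k w)
heightAt≡endHeight w k = sym (trans (endHeight-counts (+ 0) (take k w)) (ℤP.+-identityˡ _))

endHeight-downs : ∀ h r → endHeight h (replicate r D) ℤ.+ + r ≡ h
endHeight-downs h zero    = ℤP.+-identityʳ h
endHeight-downs h (suc r) = begin
  e ℤ.+ + suc r            ≡⟨ shift e (+ r) ⟩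
  ℤ.suc (e ℤ.+ + r)        ≡⟨ cong ℤ.suc (endHeight-downs (ℤ.pred h) r) ⟩
  ℤ.suc (ℤ.pred h)         ≡⟨ ℤP.suc-pred h ⟩
  h                        ∎
  where
  open ≡-Reasoning
  e = endHeight (ℤ.pred h) (replicate r D)
  shift : ∀ e x → e ℤ.+ (+ 1 ℤ.+ x) ≡ + 1 ℤ.+ (e ℤ.+ x)
  shift = solve-∀

profile-end : ∀ (w : Word) → profile w (countU w) ≡ endHeight (+ 0) w
profile-end w = trans (cong (nthOr (+ 0) (profileFrom (+ 0) w)) len)
                      (nthOr-++ʳ (upHeights (+ 0) w) _ 0)
  where
  len : countU w ≡ length (upHeights (+ 0) w) + 0
  len = sym (trans (ℕP.+-identityʳ _) (length-upHeights (+ 0) w))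

profile-beyond : ∀ (w : Word) {a} → countU w < a → profile w a ≡ + 0
profile-beyond w a> = cong (fromMaybe (+ 0)) (nth-beyond (profileFrom (+ 0) w) len≤)
  where
  len≤ : length (profileFrom (+ 0) w) ≤ _
  len≤ = subst (_≤ _) (sym (trans (LP.length-++ (upHeights (+ 0) w)) (trans (cong (_+ 1) (length-upHeights (+ 0) w)) (ℕP.+-comm _ 1)))) a>

data NoLeadingD : Word → Set where
  []  : NoLeadingD []
  U∷_ : ∀ w → NoLeadingD (U ∷ w)

profileFrom-at : ∀ h (X v : Word) → NoLeadingD v →
                 nthOr (+ 0) (profileFrom h (X ++ v)) (countU X) ≡ endHeight h X
profileFrom-at h []      []      []      = refl
profileFrom-at h []      (U ∷ v) (U∷ .v) = refl
profileFrom-at h (U ∷ X) v       nld = profileFrom-at (ℤ.suc h) X v nld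
profileFrom-at h (D ∷ X) v       nld = profileFrom-at (ℤ.pred h) X v nld

profileFrom-head≤ : ∀ h (w : Word) → nthOr (+ 0) (profileFrom h w) 0 ℤ.≤ h
profileFrom-head≤ h []      = ℤP.≤-refl
profileFrom-head≤ h (U ∷ w) = ℤP.≤-refl
profileFrom-head≤ h (D ∷ w) = ℤP.≤-trans (profileFrom-head≤ (ℤ.pred h) w) (ℤP.i≤j⇒pred[i]≤j ℤP.≤-refl)

upHeights-≥ : ∀ {m} h (w : Word) → (∀ k → m ℤ.≤ endHeight h (take k w)) → All (m ℤ.≤_) (upHeights h w)
upHeights-≥ h []      _     = []
upHeights-≥ h (U ∷ w) bound = bound 0 ∷ upHeights-≥ (ℤ.suc h) w (λ k → bound (suc k))
upHeights-≥ h (D ∷ w) bound = upHeights-≥ (ℤ.pred h) w (λ k → bound (suc k))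

endHeight-dyck : ∀ {n w} → DyckPath n w → ∀ h → endHeight h w ≡ h
endHeight-dyck {n} {w} (countU≡ , countD≡ , _) h = begin
  endHeight h w                       ≡⟨ endHeight-counts h w ⟩
  h ℤ.+ (+ countU w ℤ.- + countD w)   ≡⟨ cong₂ (λ u d → h ℤ.+ (+ u ℤ.- + d)) countU≡ countD≡ ⟩
  h ℤ.+ (+ n ℤ.- + n)                 ≡⟨ cong (λ z → h ℤ.+ z) (ℤP.+-inverseʳ (+ n)) ⟩
  h ℤ.+ + 0                           ≡⟨ ℤP.+-identityʳ h ⟩
  h                                   ∎
  where open ≡-Reasoning

upHeights-dyck : ∀ {n w} → DyckPath n w → ∀ h → All (h ℤ.≤_) (upHeights h w)
upHeights-dyck {w = w} (_ , _ , nonneg) h = upHeights-≥ h w above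
  where
  above : ∀ k → h ℤ.≤ endHeight h (take k w)
  above k = subst₂ ℤ._≤_ (ℤP.+-identityʳ h) (sym (endHeight-counts h (take k w))) (ℤP.+-monoʳ-≤ h (nonneg k))

-- Tamari order and strict minima of the profile

StrictMinOn : {A : Set} → (A → A → Set) → (ℕ → A) → ℕ → ℕ → Set
StrictMinOn _≺_ f a b = ∀ c → a < c → c ≤ b → f a ≺ f c

data Region (lx ly : ℕ) : ℕ → Set where
  left   : ∀ {c} → c < lx → Region lx ly c
  middle : ∀ k → k < ly → Region lx ly (lx + k)
  right  : ∀ k → Region lx ly (lx + (ly + k))

region : ∀ lx ly c → Region lx ly c
region lx ly c with c ℕP.<? lx
... | yes c<lx = left c<lx
... | no  c≮lx with c ∸ lx ℕP.<? ly
...   | yes k<ly = subst (Region lx ly) (ℕP.m+[n∸m]≡n (ℕP.≮⇒≥ c≮lx)) (middle (c ∸ lx) k<ly)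
...   | no  k≮ly = subst (Region lx ly) eq (right (c ∸ lx ∸ ly))
  where
  eq : lx + (ly + (c ∸ lx ∸ ly)) ≡ c
  eq = trans (cong (λ z → lx + z) (ℕP.m+[n∸m]≡n (ℕP.≮⇒≥ k≮ly))) (ℕP.m+[n∸m]≡n (ℕP.≮⇒≥ c≮lx))

strictMinOn-raise : ∀ {y₀ a b} (X Y Z : List ℤ) → All (y₀ ℤ.≤_) Y → nthOr (+ 0) Z 0 ℤ.≤ y₀ →
                    StrictMinOn ℤ._<_ (nthOr (+ 0) (X ++ Y ++ Z)) a b →
                    StrictMinOn ℤ._<_ (nthOr (+ 0) (X ++ map ℤ.suc Y ++ Z)) a b
strictMinOn-raise {y₀} {a} {b} X Y Z Y≥y₀ Z₀≤y₀ min = raised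
  where
  lx = length X
  ly = length Y
  sY = map ℤ.suc Y

  f g : ℕ → ℤ
  f = nthOr (+ 0) (X ++ Y ++ Z)
  g = nthOr (+ 0) (X ++ sY ++ Z)

  ly≡ : length sY ≡ ly
  ly≡ = LP.length-map ℤ.suc Y

  g-left : ∀ {c} → c < lx → g c ≡ f c
  g-left c< = trans (nthOr-++ˡ X _ c<) (sym (nthOr-++ˡ X _ c<))

  g-right : ∀ k → g (lx + (ly + k)) ≡ f (lx + (ly + k))
  g-right k = begin
    g (lx + (ly + k))                    ≡⟨ nthOr-++ʳ X _ _ ⟩
    nthOr (+ 0) (sY ++ Z) (ly + k)       ≡⟨ cong (λ l → nthOr (+ 0) (sY ++ Z) (l + k)) (sym ly≡) ⟩
    nthOr (+ 0) (sY ++ Z) (length sY + k) ≡⟨ nthOr-++ʳ sY Z k ⟩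
    nthOr (+ 0) Z k                      ≡⟨ sym (nthOr-++ʳ Y Z k) ⟩
    nthOr (+ 0) (Y ++ Z) (ly + k)        ≡⟨ sym (nthOr-++ʳ X _ _) ⟩
    f (lx + (ly + k))                    ∎
    where open ≡-Reasoning

  f-middle : ∀ {k} → k < ly → f (lx + k) ≡ nthOr (+ 0) Y k
  f-middle k< = trans (nthOr-++ʳ X _ _) (nthOr-++ˡ Y Z k<)

  g-middle : ∀ {k} → k < ly → g (lx + k) ≡ ℤ.suc (f (lx + k))
  g-middle {k} k< = begin
    g (lx + k)                 ≡⟨ nthOr-++ʳ X _ _ ⟩
    nthOr (+ 0) (sY ++ Z) k    ≡⟨ nthOr-++ˡ sY Z (subst (k <_) (sym ly≡) k<) ⟩
    nthOr (+ 0) sY k           ≡⟨ nthOr-map ℤ.suc Y k< ⟩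
    ℤ.suc (nthOr (+ 0) Y k)    ≡⟨ cong ℤ.suc (sym (f-middle k<)) ⟩
    ℤ.suc (f (lx + k))         ∎
    where open ≡-Reasoning

  y₀≤middle : ∀ {k} → k < ly → y₀ ℤ.≤ f (lx + k)
  y₀≤middle k< = subst (y₀ ℤ.≤_) (sym (f-middle k<)) (nthOr-All Y Y≥y₀ k<)

  f≤g : ∀ c → f c ℤ.≤ g c
  f≤g c with region lx ly c
  ... | left c<     = ℤP.≤-reflexive (sym (g-left c<))
  ... | middle k k< = subst (f (lx + k) ℤ.≤_) (sym (g-middle k<)) (ℤP.i≤suc[i] _)
  ... | right k     = ℤP.≤-reflexive (sym (g-right k))

  raised : StrictMinOn ℤ._<_ g a b
  raised c a<c c≤b with region lx ly a
  ... | left a<      = subst (ℤ._< g c) (sym (g-left a<)) (ℤP.<-≤-trans (min c a<c c≤b) (f≤g c))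
  ... | right k      = subst (ℤ._< g c) (sym (g-right k)) (ℤP.<-≤-trans (min c a<c c≤b) (f≤g c))
  ... | middle k k< with region lx ly c
  ...   | left c<       = ⊥-elim (ℕP.<-asym a<c (ℕP.<-≤-trans c< (ℕP.m≤m+n lx k)))
  ...   | middle k′ k′< = subst₂ ℤ._<_ (sym (g-middle k<)) (sym (g-middle k′<))
                                 (ℤP.+-monoʳ-< (+ 1) (min c a<c c≤b))
  ...   | right k′      = ⊥-elim (ℤP.<-irrefl refl (ℤP.≤-<-trans (y₀≤middle k<) (ℤP.<-≤-trans (min end a<end end≤b) end≤y₀)))
    where
    end = lx + (ly + 0)
    a<end : lx + k < end
    a<end = ℕP.+-monoʳ-< lx (ℕP.<-≤-trans k< (ℕP.m≤m+n ly 0))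
    end≤b : end ≤ b
    end≤b = ℕP.≤-trans (ℕP.+-monoʳ-≤ lx (ℕP.+-monoʳ-≤ ly z≤n)) c≤b
    end≤y₀ : f end ℤ.≤ y₀
    end≤y₀ = subst (ℤ._≤ y₀) (sym (trans (nthOr-++ʳ X _ _) (nthOr-++ʳ Y Z 0))) Z₀≤y₀

-- The cover raises the heights of the up steps of the Dyck path U by one; they
-- are at least y₀, while the profile right after U is at most y₀.
profile-cover : ∀ {P Q a b} → TamariCover P Q →
                StrictMinOn ℤ._<_ (profile P) a b → StrictMinOn ℤ._<_ (profile Q) a b
profile-cover {a = a} {b} (cover A B C ((_ , dyck) , _)) =
  subst₂ (λ p q → StrictMinOn ℤ._<_ (nthOr (+ 0) p) a b → StrictMinOn ℤ._<_ (nthOr (+ 0) q) a b)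
         (sym profileP) (sym profileQ)
         (strictMinOn-raise X Y Z (upHeights-dyck dyck y₀) (profileFrom-head≤ y₀ C))
  where
  W = U ∷ B ++ D ∷ []
  e = endHeight (+ 0) A
  y₀ = ℤ.pred e
  X = upHeights (+ 0) A
  Y = upHeights y₀ W
  Z = profileFrom y₀ C
  open ≡-Reasoning

  profileP : profileFrom (+ 0) (A ++ D ∷ W ++ C) ≡ X ++ Y ++ Z
  profileP = begin
    profileFrom (+ 0) (A ++ D ∷ W ++ C)          ≡⟨ profileFrom-++ (+ 0) A _ ⟩
    X ++ profileFrom y₀ (W ++ C)                 ≡⟨ cong (X ++_) (profileFrom-++ y₀ W C) ⟩
    X ++ Y ++ profileFrom (endHeight y₀ W) C     ≡⟨ cong (λ h → X ++ Y ++ profileFrom h C) (endHeight-dyck dyck y₀) ⟩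
    X ++ Y ++ Z                                  ∎

  profileQ : profileFrom (+ 0) (A ++ W ++ D ∷ C) ≡ X ++ map ℤ.suc Y ++ Z
  profileQ = begin
    profileFrom (+ 0) (A ++ W ++ D ∷ C)                  ≡⟨ profileFrom-++ (+ 0) A _ ⟩
    X ++ profileFrom e (W ++ D ∷ C)                      ≡⟨ cong (X ++_) (profileFrom-++ e W (D ∷ C)) ⟩
    X ++ upHeights e W ++ profileFrom (endHeight e W) (D ∷ C)
      ≡⟨ cong (λ h → X ++ upHeights e W ++ profileFrom h (D ∷ C)) (endHeight-dyck dyck e) ⟩
    X ++ upHeights e W ++ Z                              ≡⟨ cong (λ h → X ++ upHeights h W ++ Z) (sym (ℤP.suc-pred e)) ⟩
    X ++ upHeights (ℤ.suc y₀) W ++ Z                     ≡⟨ cong (λ ys → X ++ ys ++ Z) (upHeights-suc y₀ W) ⟩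
    X ++ map ℤ.suc Y ++ Z                                ∎

profile-tamari : ∀ {P Q a b} → P ≤T Q →
                 StrictMinOn ℤ._<_ (profile P) a b → StrictMinOn ℤ._<_ (profile Q) a b
profile-tamari ε        = id
profile-tamari (c ◅ cs) = profile-tamari cs ∘ profile-cover c

-- Rays

lastBelow : {P : ℕ → Set} → Decidable P → ℕ → Maybe ℕ
lastBelow P? zero    = nothing
lastBelow P? (suc c) = if does (P? c) then just c else lastBelow P? c

module _ {P : ℕ → Set} (P? : Decidable P) where

  lastBelow-sound : ∀ {c a} → lastBelow P? c ≡ just a →
                    a < c × P a × (∀ b → a < b → b < c → ¬ P b)
  lastBelow-sound {suc c} eq with P? c
  lastBelow-sound {suc c} refl | yes Pc =
    ℕP.≤-refl , Pc , λ b c<b b≤c → ⊥-elim (ℕP.<-irrefl refl (ℕP.<-≤-trans c<b (ℕP.≤-pred b≤c)))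
  ... | no ¬Pc with lastBelow-sound eq
  ...   | a<c , Pa , none = ℕP.m≤n⇒m≤1+n a<c , Pa , none′
    where
    none′ : ∀ b → _ < b → b < suc c → ¬ P b
    none′ b a<b b<sc with ℕP.m≤n⇒m<n∨m≡n (ℕP.≤-pred b<sc)
    ... | inj₁ b<c  = none b a<b b<c
    ... | inj₂ refl = ¬Pc

  lastBelow-complete : ∀ {a c} → a < c → P a → ∃[ a′ ] lastBelow P? c ≡ just a′ × a ≤ a′
  lastBelow-complete {c = suc c} a<sc Pa with P? c
  ... | yes _  = c , refl , ℕP.≤-pred a<sc
  ... | no ¬Pc with ℕP.m≤n⇒m<n∨m≡n (ℕP.≤-pred a<sc)
  ...   | inj₁ a<c  = lastBelow-complete a<c Pa
  ...   | inj₂ refl = ⊥-elim (¬Pc Pa)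

  lastBelow-skip : ∀ {c} → ¬ P c → lastBelow P? (suc c) ≡ lastBelow P? c
  lastBelow-skip {c} ¬Pc rewrite dec-false (P? c) ¬Pc = refl

module Rays (H : ℕ → ℕ) (H-step : ∀ a → H (suc a) ≤ suc (H a)) where

  UpUp : ℕ → Set
  UpUp a = H (suc a) ≡ suc (H a)

  DoubleUpAt : ℕ → ℕ → Set
  DoubleUpAt h a = UpUp a × suc (H a) ≡ h

  doubleUpAt? : ∀ h → Decidable (DoubleUpAt h)
  doubleUpAt? h a = (H (suc a) ℕP.≟ suc (H a)) ×-dec (suc (H a) ℕP.≟ h)

  -- The ray from the foot of the descent after up step i, at height H (suc i),
  -- first meets the top of the last up step j < i followed by an up step and
  -- ending at that height.
  ray : ℕ → Maybe ℕ
  ray i = lastBelow (doubleUpAt? (H (suc i))) i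

  upcrossing : ∀ {x y t} → x < y → H x < t → t ≤ H y → ∃[ a ] x ≤ a × a < y × DoubleUpAt t a
  upcrossing {y = suc y} {t} x<sy Hx<t t≤Hsy with H y ℕP.<? t
  ... | yes Hy<t = y , ℕP.≤-pred x<sy , ℕP.≤-refl ,
                   ℕP.≤-antisym (H-step y) (ℕP.≤-trans Hy<t t≤Hsy) ,
                   ℕP.≤-antisym Hy<t (ℕP.≤-trans t≤Hsy (H-step y))
  ... | no Hy≮t with ℕP.m≤n⇒m<n∨m≡n (ℕP.≤-pred x<sy)
  ...   | inj₂ refl = ⊥-elim (Hy≮t Hx<t)
  ...   | inj₁ x<y with upcrossing x<y Hx<t (ℕP.≮⇒≥ Hy≮t)
  ...     | a , x≤a , a<y , up = a , x≤a , ℕP.m≤n⇒m≤1+n a<y , up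

  ray-strictMin : ∀ {i j} → ¬ UpUp i → ray i ≡ just j → j < i × StrictMinOn _<_ H j (suc i)
  ray-strictMin {i} {j} ¬up eq with lastBelow-sound (doubleUpAt? (H (suc i))) eq
  ... | j<i , (_ , Hsj≡) , none = j<i , below
    where
    below : StrictMinOn _<_ H j (suc i)
    below c j<c c≤si with H j ℕP.<? H c
    ... | yes Hj<Hc = Hj<Hc
    ... | no Hj≮Hc with ℕP.m≤n⇒m<n∨m≡n c≤si
    ...   | inj₂ refl = ⊥-elim (Hj≮Hc (ℕP.≤-reflexive Hsj≡))
    ...   | inj₁ c<si with upcrossing c<si (s≤s (ℕP.≮⇒≥ Hj≮Hc)) (ℕP.≤-reflexive Hsj≡)
    ...     | a , c≤a , a<si , (up , Ha≡) with ℕP.m≤n⇒m<n∨m≡n (ℕP.≤-pred a<si)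
    ...       | inj₂ refl = ⊥-elim (¬up up)
    ...       | inj₁ a<i  = ⊥-elim (none a (ℕP.<-≤-trans j<c c≤a) a<i (up , trans Ha≡ Hsj≡))

  ray-nested : ∀ {i l c} → ¬ UpUp i → i < l → ¬ UpUp l → ray l ≡ just c → c ≤ i →
               ∃[ j ] ray i ≡ just j × c ≤ j
  ray-nested {i} ¬up-i i<l ¬up-l eq c≤i with ray-strictMin ¬up-l eq
  ... | _ , below with upcrossing (s≤s c≤i) (below (suc i) (s≤s c≤i) (ℕP.<⇒≤ (s≤s i<l))) ℕP.≤-refl
  ...   | a , c≤a , a<si , (up , Ha≡) with ℕP.m≤n⇒m<n∨m≡n (ℕP.≤-pred a<si)
  ...     | inj₂ refl = ⊥-elim (¬up-i up)
  ...     | inj₁ a<i with lastBelow-complete (doubleUpAt? (H (suc i))) a<i (up , Ha≡)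
  ...       | j , eq′ , a≤j = j , eq′ , ℕP.≤-trans c≤a a≤j

countU-++ : ∀ (v v′ : Word) → countU (v ++ v′) ≡ countU v + countU v′
countU-++ []      v′ = refl
countU-++ (U ∷ v) v′ = cong suc (countU-++ v v′)
countU-++ (D ∷ v) v′ = countU-++ v v′

countU-downs : ∀ r → countU (replicate r D) ≡ 0
countU-downs zero    = refl
countU-downs (suc r) = countU-downs r

upPos-exists : ∀ (w : Word) {a} → a < countU w → ∃[ p ] upPos w a ≡ just p
upPos-exists (U ∷ w) {zero}  _        = 0 , refl
upPos-exists (U ∷ w) {suc a} (s≤s a<) with upPos w a | upPos-exists w a<
... | just p | _ = suc p , refl
upPos-exists (D ∷ w) {a} a< with upPos w a | upPos-exists w a<
... | just p | _ = suc p , refl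

upPos-split : ∀ (w : Word) {a p} → upPos w a ≡ just p →
              ∃[ X ] ∃[ v ] w ≡ X ++ U ∷ v × length X ≡ p × countU X ≡ a
upPos-split (U ∷ w) {zero} refl = [] , w , refl , refl , refl
upPos-split (U ∷ w) {suc a} eq with upPos w a in e
upPos-split (U ∷ w) {suc a} refl | just q with upPos-split w e
... | X , v , refl , refl , refl = U ∷ X , v , refl , refl , refl
upPos-split (D ∷ w) {a} eq with upPos w a in e
upPos-split (D ∷ w) {a} refl | just q with upPos-split w e
... | X , v , refl , refl , refl = D ∷ X , v , refl , refl , refl

downs-split : ∀ (v : Word) → ∃[ r ] ∃[ Y ] v ≡ replicate r D ++ Y × NoLeadingD Y
downs-split []      = 0 , [] , refl , []
downs-split (U ∷ v) = 0 , U ∷ v , refl , U∷ v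
downs-split (D ∷ v) with downs-split v
... | r , Y , refl , nld = suc r , Y , refl , nld

downRun-after-up : ∀ (X v : Word) → downRun (X ++ U ∷ v) (suc (length X)) ≡ downRun v 0
downRun-after-up []      v = refl
downRun-after-up (U ∷ X) v = downRun-after-up X v
downRun-after-up (D ∷ X) v = downRun-after-up X v

downRun-downs : ∀ r {Y} → NoLeadingD Y → downRun (replicate r D ++ Y) 0 ≡ r
downRun-downs zero    []      = refl
downRun-downs zero    (U∷ Y)  = refl
downRun-downs (suc r) nld     = cong suc (downRun-downs r nld)

data AfterUp (a p r : ℕ) : Word → Set where
  split : ∀ X {Y} → length X ≡ p → countU X ≡ a → NoLeadingD Y →
          AfterUp a p r (X ++ U ∷ replicate r D ++ Y)

afterUp : ∀ (w : Word) {a p} → upPos w a ≡ just p → AfterUp a p (downRun w (suc p)) w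
afterUp w e with upPos-split w e
... | X , v , refl , refl , refl with downs-split v
...   | r , Y , refl , nld =
  subst (λ r′ → AfterUp _ _ r′ (X ++ U ∷ replicate r D ++ Y))
        (sym (trans (downRun-after-up X _) (downRun-downs r nld)))
        (split X refl refl nld)

countU-take-downs : ∀ {k r} (Y : Word) → k ≤ r → countU (take k (replicate r D ++ Y)) ≡ 0
countU-take-downs {zero}          Y _         = refl
countU-take-downs {suc k} {suc r} Y (s≤s k≤r) = countU-take-downs Y k≤r

nth-after-up : ∀ (X : Word) {v} → nth (X ++ U ∷ v) (suc (length X)) ≡ nth v 0
nth-after-up []      = refl
nth-after-up (s ∷ X) = nth-after-up X

profile-foot : ∀ X {r Y} → NoLeadingD Y →
               profile (X ++ U ∷ replicate r D ++ Y) (suc (countU X)) ≡ endHeight (+ 0) (X ++ U ∷ replicate r D)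
profile-foot X {r} {Y} nld = begin
  profile (X ++ U ∷ Ds ++ Y) (suc (countU X))
    ≡⟨ cong₂ (λ v k → nthOr (+ 0) (profileFrom (+ 0) v) k) (sym (LP.++-assoc X (U ∷ Ds) Y)) count ⟩
  nthOr (+ 0) (profileFrom (+ 0) ((X ++ U ∷ Ds) ++ Y)) (countU (X ++ U ∷ Ds))
    ≡⟨ profileFrom-at (+ 0) (X ++ U ∷ Ds) Y nld ⟩
  endHeight (+ 0) (X ++ U ∷ Ds) ∎
  where
  open ≡-Reasoning
  Ds = replicate r D
  count : suc (countU X) ≡ countU (X ++ U ∷ Ds)
  count = sym (trans (countU-++ X (U ∷ Ds)) (trans (cong (λ c → countU X + suc c) (countU-downs r)) (ℕP.+-comm (countU X) 1)))

module _ {a p r : ℕ} where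

  afterUp-up : ∀ {w} → AfterUp a p r w → profile w a ≡ heightAt w p
  afterUp-up {w} (split X refl refl _) = begin
    profile w (countU X)                 ≡⟨ profileFrom-at (+ 0) X _ (U∷ _) ⟩
    endHeight (+ 0) X                    ≡⟨ cong (endHeight (+ 0)) (sym (take-length-++ X _)) ⟩
    endHeight (+ 0) (take (length X) w)  ≡⟨ sym (heightAt≡endHeight w (length X)) ⟩
    heightAt w (length X)                ∎
    where open ≡-Reasoning

  afterUp-descent : ∀ {w} → AfterUp a p r w → profile w (suc a) ≡ endHeight (ℤ.suc (profile w a)) (replicate r D)
  afterUp-descent {w} (split X refl refl nld) = begin
    profile w (suc (countU X))                    ≡⟨ profile-foot X nld ⟩
    endHeight (+ 0) (X ++ U ∷ replicate r D)      ≡⟨ endHeight-++ (+ 0) X (U ∷ replicate r D) ⟩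
    endHeight (ℤ.suc (endHeight (+ 0) X)) (replicate r D)
      ≡⟨ cong (λ h → endHeight (ℤ.suc h) (replicate r D)) (sym (profileFrom-at (+ 0) X _ (U∷ _))) ⟩
    endHeight (ℤ.suc (profile w (countU X))) (replicate r D) ∎
    where open ≡-Reasoning

  afterUp-foot : ∀ {w} → AfterUp a p r w → heightAt w (suc p + r) ≡ profile w (suc a)
  afterUp-foot {w} (split X {Y} refl refl nld) = begin
    heightAt w (suc (length X) + r)                   ≡⟨ heightAt≡endHeight w (suc (length X) + r) ⟩
    endHeight (+ 0) (take (suc (length X) + r) w)     ≡⟨ cong (λ k → endHeight (+ 0) (take k w)) (sym (ℕP.+-suc (length X) r)) ⟩
    endHeight (+ 0) (take (length X + suc r) w)       ≡⟨ cong (endHeight (+ 0)) (take-length+-++ X _ (suc r)) ⟩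
    endHeight (+ 0) (X ++ U ∷ take r (replicate r D ++ Y))
      ≡⟨ cong (λ v → endHeight (+ 0) (X ++ U ∷ v)) (take-replicate-++ r D Y) ⟩
    endHeight (+ 0) (X ++ U ∷ replicate r D)          ≡⟨ sym (profile-foot X nld) ⟩
    profile w (suc (countU X))                        ∎
    where open ≡-Reasoning

  afterUp-count-up : ∀ {w} → AfterUp a p r w → countU (take p w) ≡ a
  afterUp-count-up (split X refl refl _) = cong countU (take-length-++ X _)

  afterUp-count-descent : ∀ {w k} → AfterUp a p r w → k ≤ r → countU (take (suc p + k) w) ≡ suc a
  afterUp-count-descent {w} {k} (split X {Y} refl refl _) k≤r = begin
    countU (take (suc (length X) + k) w)                    ≡⟨ cong (λ m → countU (take m w)) (sym (ℕP.+-suc (length X) k)) ⟩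
    countU (take (length X + suc k) w)                      ≡⟨ cong countU (take-length+-++ X _ (suc k)) ⟩
    countU (X ++ U ∷ take k (replicate r D ++ Y))           ≡⟨ countU-++ X _ ⟩
    countU X + suc (countU (take k (replicate r D ++ Y)))   ≡⟨ cong (λ c → countU X + suc c) (countU-take-downs Y k≤r) ⟩
    countU X + 1                                            ≡⟨ ℕP.+-comm (countU X) 1 ⟩
    suc (countU X)                                          ∎
    where open ≡-Reasoning

afterUp-next-down : ∀ {a p r w} → AfterUp a p (suc r) w → nth w (suc p) ≡ just D
afterUp-next-down (split X refl refl _) = nth-after-up X

afterUp-next-flat : ∀ {a p w} → AfterUp a p 0 w → nth w (suc p) ≡ just U ⊎ suc a ≡ countU w
afterUp-next-flat (split X refl refl (U∷ _)) = inj₁ (nth-after-up X)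
afterUp-next-flat (split X refl refl [])     = inj₂ (sym (trans (countU-++ X (U ∷ [])) (ℕP.+-comm (countU X) 1)))

nthU-upPos : ∀ (w : Word) {q} → nth w q ≡ just U → upPos w (countU (take q w)) ≡ just q
nthU-upPos (U ∷ w) {zero}  _ = refl
nthU-upPos (U ∷ w) {suc q} e rewrite nthU-upPos w e = refl
nthU-upPos (D ∷ w) {suc q} e rewrite nthU-upPos w e = refl

countU-take-U : ∀ (w : Word) {q} → nth w q ≡ just U → countU (take (suc q) w) ≡ suc (countU (take q w))
countU-take-U (U ∷ w) {zero}  _ = refl
countU-take-U (U ∷ w) {suc q} e = cong suc (countU-take-U w e)
countU-take-U (D ∷ w) {suc q} e = countU-take-U w e

countU-take-¬U : ∀ (w : Word) {q} → isU (nth w q) ≡ false → countU (take (suc q) w) ≡ countU (take q w)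
countU-take-¬U []      {zero}  _ = refl
countU-take-¬U []      {suc q} _ = refl
countU-take-¬U (D ∷ w) {zero}  _ = refl
countU-take-¬U (U ∷ w) {suc q} e = cong suc (countU-take-¬U w e)
countU-take-¬U (D ∷ w) {suc q} e = countU-take-¬U w e

endHeight-take-U : ∀ h (w : Word) {q} → nth w q ≡ just U → endHeight h (take (suc q) w) ≡ ℤ.suc (endHeight h (take q w))
endHeight-take-U h (U ∷ w) {zero}  _ = refl
endHeight-take-U h (U ∷ w) {suc q} e = endHeight-take-U (ℤ.suc h) w e
endHeight-take-U h (D ∷ w) {suc q} e = endHeight-take-U (ℤ.pred h) w e

heightAt-U : ∀ (w : Word) {q} → nth w q ≡ just U → heightAt w (suc q) ≡ ℤ.suc (heightAt w q)
heightAt-U w {q} e = begin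
  heightAt w (suc q)                        ≡⟨ heightAt≡endHeight w (suc q) ⟩
  endHeight (+ 0) (take (suc q) w)          ≡⟨ endHeight-take-U (+ 0) w e ⟩
  ℤ.suc (endHeight (+ 0) (take q w))        ≡⟨ cong ℤ.suc (sym (heightAt≡endHeight w q)) ⟩
  ℤ.suc (heightAt w q)                      ∎
  where open ≡-Reasoning

upStepEndingAt : Word → ℕ → ℕ
upStepEndingAt w k = countU (take (k ∸ 1) w)

rayIndex-search : ∀ (w : Word) {i p} → upPos w i ≡ just p →
                  let r = downRun w (suc p) in
                  rayIndex w i ≡ Maybe.map (upStepEndingAt w) (searchLeft w (heightAt w (suc p + r)) (p + r))
rayIndex-search w {p = p} e rewrite e with searchLeft w (heightAt w (suc p + downRun w (suc p))) (p + downRun w (suc p))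
... | nothing = refl
... | just k  = refl

letter : Bool → Letter
letter b = if b then E else N

letter-injective : ∀ {b c} → letter b ≡ letter c → b ≡ c
letter-injective {true}  {true}  _ = refl
letter-injective {false} {false} _ = refl

nextLetters-upPos : ∀ (w : Word) {a p} → upPos w a ≡ just p → nth (nextLetters w) a ≡ just (letter (isU (nth w (suc p))))
nextLetters-upPos (U ∷ [])    {zero} refl = refl
nextLetters-upPos (U ∷ U ∷ w) {zero} refl = refl
nextLetters-upPos (U ∷ D ∷ w) {zero} refl = refl
nextLetters-upPos (U ∷ U ∷ w) {suc a} eq with upPos (U ∷ w) a in e
nextLetters-upPos (U ∷ U ∷ w) {suc a} refl | just q = nextLetters-upPos (U ∷ w) e
nextLetters-upPos (U ∷ D ∷ w) {suc a} eq with upPos (D ∷ w) a in e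
nextLetters-upPos (U ∷ D ∷ w) {suc a} refl | just q = nextLetters-upPos (D ∷ w) e
nextLetters-upPos (D ∷ w)     {a}     eq with upPos w a in e
nextLetters-upPos (D ∷ w)     {a}     refl | just q = nextLetters-upPos w e

Type-upPos : ∀ (w : Word) {a p} → a < countU w ∸ 1 → upPos w a ≡ just p → nth (Type w) a ≡ just (letter (isU (nth w (suc p))))
Type-upPos w a< e = trans (nth-take (nextLetters w) a<) (nextLetters-upPos w e)

module DyckProfile {n} {w : Word} (dyck : DyckPath n w) where

  profile-nonneg : ∀ a → + 0 ℤ.≤ profile w a
  profile-nonneg a with ℕP.<-cmp a (countU w)
  ... | tri< a< _ _ with upPos-exists w a<
  ...   | p , e = subst (+ 0 ℤ.≤_) (sym (afterUp-up (afterUp w e))) (proj₂ (proj₂ dyck) p)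
  profile-nonneg a | tri≈ _ refl _ = ℤP.≤-reflexive (sym (trans (profile-end w) (endHeight-dyck dyck (+ 0))))
  profile-nonneg a | tri> _ _ a>   = ℤP.≤-reflexive (sym (profile-beyond w a>))

  H : ℕ → ℕ
  H a = ℤ.∣ profile w a ∣

  profile≡H : ∀ a → profile w a ≡ + H a
  profile≡H a = sym (ℤP.0≤i⇒+∣i∣≡i (profile-nonneg a))

  H-end : H (countU w) ≡ 0
  H-end = cong ℤ.∣_∣ (trans (profile-end w) (endHeight-dyck dyck (+ 0)))

  H-descent : ∀ {a p} → upPos w a ≡ just p → H (suc a) + downRun w (suc p) ≡ suc (H a)
  H-descent {a} {p} e = ℤP.+-injective (begin
    + H (suc a) ℤ.+ + r                             ≡⟨ cong (ℤ._+ + r) (sym (profile≡H (suc a))) ⟩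
    profile w (suc a) ℤ.+ + r                       ≡⟨ cong (ℤ._+ + r) (afterUp-descent (afterUp w e)) ⟩
    endHeight (ℤ.suc (profile w a)) (replicate r D) ℤ.+ + r ≡⟨ endHeight-downs _ r ⟩
    ℤ.suc (profile w a)                             ≡⟨ cong ℤ.suc (profile≡H a) ⟩
    + suc (H a)                                     ∎)
    where
    open ≡-Reasoning
    r = downRun w (suc p)

  H-step : ∀ a → H (suc a) ≤ suc (H a)
  H-step a with a ℕP.<? countU w
  ... | yes a< = subst (H (suc a) ≤_) (H-descent (proj₂ (upPos-exists w a<))) (ℕP.m≤m+n _ _)
  ... | no  a≮ = subst (_≤ suc (H a)) (sym (cong ℤ.∣_∣ (profile-beyond w (s≤s (ℕP.≮⇒≥ a≮))))) z≤n

  open Rays H H-step public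

  ¬UpUp-descent : ∀ {a r} → H (suc a) + suc r ≡ suc (H a) → ¬ UpUp a
  ¬UpUp-descent {a} {r} descent up = ℕP.m+1+n≢m (suc (H a)) (trans (cong (_+ suc r) (sym up)) descent)

  isU-next : ∀ {a p} → upPos w a ≡ just p → isU (nth w (suc p)) ≡ does (H (suc a) ℕP.≟ suc (H a))
  isU-next {a} {p} e with downRun w (suc p) | afterUp w e | H-descent e
  ... | suc r | view | descent rewrite afterUp-next-down view =
    sym (dec-false (H (suc a) ℕP.≟ suc (H a)) (¬UpUp-descent descent))
  ... | zero  | view | descent with afterUp-next-flat view
  ...   | inj₁ nextU rewrite nextU = sym (dec-true (H (suc a) ℕP.≟ suc (H a)) (trans (sym (ℕP.+-identityʳ _)) descent))
  ...   | inj₂ last = ⊥-elim (ℕP.0≢1+n (trans (sym H-end) (trans (cong H (sym last)) (trans (sym (ℕP.+-identityʳ _)) descent))))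

  heightAt-after-up : ∀ {q} → nth w q ≡ just U → heightAt w (suc q) ≡ + suc (H (countU (take q w)))
  heightAt-after-up {q} eq = begin
    heightAt w (suc q)                      ≡⟨ heightAt-U w eq ⟩
    ℤ.suc (heightAt w q)                    ≡⟨ cong ℤ.suc (sym (afterUp-up (afterUp w (nthU-upPos w eq)))) ⟩
    ℤ.suc (profile w (countU (take q w)))   ≡⟨ cong ℤ.suc (profile≡H _) ⟩
    + suc (H (countU (take q w)))           ∎
    where open ≡-Reasoning

  searchLeft-lastBelow : ∀ h K → Maybe.map (upStepEndingAt w) (searchLeft w (+ h) K)
                                 ≡ lastBelow (doubleUpAt? h) (countU (take K w))
  searchLeft-lastBelow h zero    = refl
  searchLeft-lastBelow h (suc K) = go (nth w K) refl
    where
    g = upStepEndingAt w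
    a = countU (take K w)

    step : Maybe.map g (if does (doubleUpAt? h a) then just (suc K) else searchLeft w (+ h) K)
           ≡ (if does (doubleUpAt? h a) then just a else lastBelow (doubleUpAt? h) a)
    step with does (doubleUpAt? h a)
    ... | true  = refl
    ... | false = searchLeft-lastBelow h K

    go : ∀ s → nth w K ≡ s → Maybe.map g (searchLeft w (+ h) (suc K))
                              ≡ lastBelow (doubleUpAt? h) (countU (take (suc K) w))
    go (just U) eK = begin
      Maybe.map g (searchLeft w (+ h) (suc K))
        ≡⟨ cong (λ b → Maybe.map g (if b then just (suc K) else searchLeft w (+ h) K)) condition ⟩
      Maybe.map g (if does (doubleUpAt? h a) then just (suc K) else searchLeft w (+ h) K)
        ≡⟨ step ⟩
      lastBelow (doubleUpAt? h) (suc a)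
        ≡⟨ cong (lastBelow (doubleUpAt? h)) (sym (countU-take-U w eK)) ⟩
      lastBelow (doubleUpAt? h) (countU (take (suc K) w)) ∎
      where
      open ≡-Reasoning
      condition : doubleUp w (suc K) ∧ does (heightAt w (suc K) ℤ.≟ + h) ≡ does (doubleUpAt? h a)
      condition = cong₂ _∧_ (cong₂ _∧_ (cong isU eK) (isU-next (nthU-upPos w eK)))
                            (cong (λ z → does (z ℤ.≟ + h)) (heightAt-after-up eK))
    go (just D) eK rewrite eK | countU-take-¬U w (cong isU eK) = searchLeft-lastBelow h K
    go nothing  eK rewrite eK | countU-take-¬U w (cong isU eK) = searchLeft-lastBelow h K

  ray-from-foot : ∀ {i p} → upPos w i ≡ just p →
                  lastBelow (doubleUpAt? (H (suc i))) (countU (take (p + downRun w (suc p)) w)) ≡ ray i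
  ray-from-foot {i} {p} e with downRun w (suc p) | afterUp w e | H-descent e
  ... | zero  | view | _ rewrite ℕP.+-identityʳ p = cong (lastBelow _) (afterUp-count-up view)
  ... | suc r | view | descent rewrite ℕP.+-suc p r =
    trans (cong (lastBelow _) (afterUp-count-descent view (ℕP.n≤1+n r)))
          (lastBelow-skip (doubleUpAt? (H (suc i))) (¬UpUp-descent descent ∘ proj₁))

  rayIndex≡ray : ∀ {i} → i < countU w → rayIndex w i ≡ ray i
  rayIndex≡ray {i} i< with upPos-exists w i<
  ... | p , e = begin
    rayIndex w i                                                    ≡⟨ rayIndex-search w e ⟩
    Maybe.map g (searchLeft w (heightAt w (suc p + r)) (p + r))     ≡⟨ cong (λ h → Maybe.map g (searchLeft w h (p + r))) foot ⟩
    Maybe.map g (searchLeft w (+ H (suc i)) (p + r))                ≡⟨ searchLeft-lastBelow (H (suc i)) (p + r) ⟩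
    lastBelow (doubleUpAt? (H (suc i))) (countU (take (p + r) w))   ≡⟨ ray-from-foot e ⟩
    ray i                                                           ∎
    where
    open ≡-Reasoning
    r = downRun w (suc p)
    g = upStepEndingAt w
    foot : heightAt w (suc p + r) ≡ + H (suc i)
    foot = trans (afterUp-foot (afterUp w e)) (profile≡H (suc i))

  Type-letter : ∀ {a} → a < countU w ∸ 1 → nth (Type w) a ≡ just (letter (does (H (suc a) ℕP.≟ suc (H a))))
  Type-letter a< with upPos-exists w (ℕP.<-≤-trans a< (ℕP.m∸n≤m _ 1))
  ... | p , e = trans (Type-upPos w a< e) (cong (just ∘ letter) (isU-next e))

-- Plane trees and decorations

-- Strictly increasing lists of elements of [lo, hi) satisfying P, ending at hi - 1.
data Chain (P : ℕ → Set) : ℕ → ℕ → List ℕ → Set where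
  []   : ∀ {lo hi} → lo ≡ hi → Chain P lo hi []
  cons : ∀ {lo hi l ls} → lo ≤ l → P l → Chain P (suc l) hi ls → Chain P lo hi (l ∷ ls)

module _ {P : ℕ → Set} where

  chain-lo≤hi : ∀ {lo hi ls} → Chain P lo hi ls → lo ≤ hi
  chain-lo≤hi ([] refl)         = ℕP.≤-refl
  chain-lo≤hi (cons lo≤l _ rest) = ℕP.≤-trans lo≤l (ℕP.<⇒≤ (chain-lo≤hi rest))

  chain-weaken : ∀ {lo′ lo hi ls} → lo′ ≤ lo → lo < hi → Chain P lo hi ls → Chain P lo′ hi ls
  chain-weaken _      lo<hi ([] refl)           = ⊥-elim (ℕP.<-irrefl refl lo<hi)
  chain-weaken lo′≤lo _     (cons lo≤l Pl rest) = cons (ℕP.≤-trans lo′≤lo lo≤l) Pl rest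

  chain-++ : ∀ {lo mid hi xs ys} → Chain P lo mid xs → Chain P mid hi ys → Chain P lo hi (xs ++ ys)
  chain-++ ([] refl)           rest′ = rest′
  chain-++ (cons lo≤l Pl rest) rest′ = cons lo≤l Pl (chain-++ rest rest′)

  chain-split : ∀ {lo hi} xs {l ys} → Chain P lo hi (xs ++ l ∷ ys) →
                All (λ i → lo ≤ i × i < l × P i) xs × lo ≤ l × l < hi × P l
  chain-split []       (cons lo≤l Pl rest) = [] , lo≤l , chain-lo≤hi rest , Pl
  chain-split (x ∷ xs) (cons lo≤x Px rest) with chain-split xs rest
  ... | earlier , x<l , l<hi , Pl =
    (lo≤x , x<l , Px) ∷ All.map (λ (x<i , i<l , Pi) → ℕP.≤-trans lo≤x (ℕP.<⇒≤ x<i) , i<l , Pi) earlier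
    , ℕP.≤-trans lo≤x (ℕP.<⇒≤ x<l) , l<hi , Pl

  chain-last : ∀ {lo hi ls} → lo < hi → Chain P lo hi ls → Any (λ l → suc l ≡ hi × P l) ls
  chain-last lo<hi ([] refl) = ⊥-elim (ℕP.<-irrefl refl lo<hi)
  chain-last {hi = hi} _ (cons {l = l} _ Pl rest) with suc l ℕP.<? hi
  ... | yes sl<hi = there (chain-last sl<hi rest)
  ... | no  sl≮hi = here (ℕP.≤-antisym (chain-lo≤hi rest) (ℕP.≮⇒≥ sl≮hi) , Pl)


edgesL : List Tree → ℕ
edgesL []             = 0
edgesL (node cs ∷ ts) = suc (edgesL cs + edgesL ts)

length-edgeParentDepthsL : ∀ d ts → length (edgeParentDepthsL d ts) ≡ edgesL ts
length-edgeParentDepthsL d []             = refl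
length-edgeParentDepthsL d (node cs ∷ ts) = cong suc (begin
  length (edgeParentDepthsL (suc d) cs ++ edgeParentDepthsL d ts)
    ≡⟨ LP.length-++ (edgeParentDepthsL (suc d) cs) ⟩
  length (edgeParentDepthsL (suc d) cs) + length (edgeParentDepthsL d ts)
    ≡⟨ cong₂ _+_ (length-edgeParentDepthsL (suc d) cs) (length-edgeParentDepthsL d ts) ⟩
  edgesL cs + edgesL ts ∎)
  where open ≡-Reasoning

edgeParentDepthsL-≥ : ∀ d ts → All (d ≤_) (edgeParentDepthsL d ts)
edgeParentDepthsL-≥ d []             = []
edgeParentDepthsL-≥ d (node cs ∷ ts) =
  ℕP.≤-refl ∷ AllP.++⁺ (All.map ℕP.<⇒≤ (edgeParentDepthsL-≥ (suc d) cs)) (edgeParentDepthsL-≥ d ts)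

mutual
  upHeights-contourL : ∀ d ts → upHeights (+ d) (contourL ts) ≡ map +_ (edgeParentDepthsL d ts)
  upHeights-contourL d []             = refl
  upHeights-contourL d (node cs ∷ ts) = begin
    upHeights (+ d) ((U ∷ contourL cs ++ D ∷ []) ++ contourL ts)
      ≡⟨ upHeights-++ (+ d) (U ∷ contourL cs ++ D ∷ []) _ ⟩
    (+ d ∷ upHeights (+ suc d) (contourL cs ++ D ∷ [])) ++ upHeights (endHeight (+ d) (U ∷ contourL cs ++ D ∷ [])) (contourL ts)
      ≡⟨ cong₂ (λ u h → (+ d ∷ u) ++ upHeights h (contourL ts)) inner (endHeight-planted d cs) ⟩
    (+ d ∷ map +_ (edgeParentDepthsL (suc d) cs)) ++ upHeights (+ d) (contourL ts)
      ≡⟨ cong (λ v → + d ∷ map +_ (edgeParentDepthsL (suc d) cs) ++ v) (upHeights-contourL d ts) ⟩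
    + d ∷ map +_ (edgeParentDepthsL (suc d) cs) ++ map +_ (edgeParentDepthsL d ts)
      ≡⟨ cong (+ d ∷_) (sym (LP.map-++ +_ (edgeParentDepthsL (suc d) cs) _)) ⟩
    map +_ (edgeParentDepthsL d (node cs ∷ ts)) ∎
    where
    open ≡-Reasoning
    inner : upHeights (+ suc d) (contourL cs ++ D ∷ []) ≡ map +_ (edgeParentDepthsL (suc d) cs)
    inner = trans (upHeights-++ (+ suc d) (contourL cs) (D ∷ []))
                  (trans (LP.++-identityʳ _) (upHeights-contourL (suc d) cs))

  endHeight-contourL : ∀ d ts → endHeight (+ d) (contourL ts) ≡ + d
  endHeight-contourL d []             = refl
  endHeight-contourL d (node cs ∷ ts) =
    trans (endHeight-++ (+ d) (U ∷ contourL cs ++ D ∷ []) (contourL ts))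
          (trans (cong (λ h → endHeight h (contourL ts)) (endHeight-planted d cs)) (endHeight-contourL d ts))

  endHeight-planted : ∀ d cs → endHeight (+ d) (U ∷ contourL cs ++ D ∷ []) ≡ + d
  endHeight-planted d cs =
    trans (endHeight-++ (+ suc d) (contourL cs) (D ∷ [])) (cong ℤ.pred (endHeight-contourL (suc d) cs))

profile-contourL : ∀ ts a → profile (contourL ts) a ≡ + nthOr 0 (edgeParentDepthsL 0 ts) a
profile-contourL ts a rewrite upHeights-contourL 0 ts | endHeight-contourL 0 ts = go (edgeParentDepthsL 0 ts) a
  where
  go : ∀ L a → nthOr (+ 0) (map +_ L ++ + 0 ∷ []) a ≡ + nthOr 0 L a
  go []      zero    = refl
  go []      (suc a) = refl
  go (x ∷ L) zero    = refl
  go (x ∷ L) (suc a) = go L a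

mutual
  decorated : (ℕ → ℤ) → ℕ → Tree → LTree
  decorated f i (node [])       = lf (f i)
  decorated f i (node (c ∷ cs)) = nd (decoratedL f (suc i) (c ∷ cs))

  decoratedL : (ℕ → ℤ) → ℕ → List Tree → List LTree
  decoratedL f i []             = []
  decoratedL f i (node cs ∷ ts) = decorated f i (node cs) ∷ decoratedL f (suc i + edgesL cs) ts

mutual
  decorateSub≡ : ∀ f i cs → decorateSub f i (node cs) ≡ (decorated f i (node cs) , suc i + edgesL cs)
  decorateSub≡ f i []       = cong (lf (f i) ,_) (sym (ℕP.+-identityʳ (suc i)))
  decorateSub≡ f i (c ∷ cs) = cong (λ r → nd (proj₁ r) , proj₂ r) (decorateList≡ f (suc i) (c ∷ cs))

  decorateList≡ : ∀ f i ts → decorateList f i ts ≡ (decoratedL f i ts , i + edgesL ts)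
  decorateList≡ f i []             = cong ([] ,_) (sym (ℕP.+-identityʳ i))
  decorateList≡ f i (node cs ∷ ts) = begin
    decorateList f i (node cs ∷ ts)
      ≡⟨ cong (λ r → proj₁ r ∷ proj₁ (decorateList f (proj₂ r) ts) , proj₂ (decorateList f (proj₂ r) ts))
              (decorateSub≡ f i cs) ⟩
    (decorated f i (node cs) ∷ proj₁ (decorateList f j ts) , proj₂ (decorateList f j ts))
      ≡⟨ cong (λ r → decorated f i (node cs) ∷ proj₁ r , proj₂ r) (decorateList≡ f j ts) ⟩
    (decoratedL f i (node cs ∷ ts) , j + edgesL ts)
      ≡⟨ cong (decoratedL f i (node cs ∷ ts) ,_) (trans (ℕP.+-assoc (suc i) (edgesL cs) (edgesL ts)) (sym (ℕP.+-suc i _))) ⟩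
    (decoratedL f i (node cs ∷ ts) , i + edgesL (node cs ∷ ts)) ∎
    where
    open ≡-Reasoning
    j = suc i + edgesL cs

decorate≡ : ∀ f ts → decorate f (node ts) ≡ nd (decoratedL f 0 ts)
decorate≡ f ts = cong (λ r → nd (proj₁ r)) (decorateList≡ f 0 ts)

mutual
  leafEdges : ℕ → Tree → List ℕ
  leafEdges i (node [])       = i ∷ []
  leafEdges i (node (c ∷ cs)) = leafEdgesL (suc i) (c ∷ cs)

  leafEdgesL : ℕ → List Tree → List ℕ
  leafEdgesL i []             = []
  leafEdgesL i (node cs ∷ ts) = leafEdges i (node cs) ++ leafEdgesL (suc i + edgesL cs) ts

mutual
  leaves-decorated : ∀ f i cs → leaves (decorated f i (node cs)) ≡ map f (leafEdges i (node cs))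
  leaves-decorated f i []       = refl
  leaves-decorated f i (c ∷ cs) = leavesL-decoratedL f (suc i) (c ∷ cs)

  leavesL-decoratedL : ∀ f i ts → leavesL (decoratedL f i ts) ≡ map f (leafEdgesL i ts)
  leavesL-decoratedL f i []             = refl
  leavesL-decoratedL f i (node cs ∷ ts) =
    trans (cong₂ _++_ (leaves-decorated f i cs) (leavesL-decoratedL f (suc i + edgesL cs) ts))
          (sym (LP.map-++ f (leafEdges i (node cs)) _))

edgeParentDepthsL-head≤ : ∀ {d after} ts → nthOr 0 after 0 ≤ d → nthOr 0 (edgeParentDepthsL d ts ++ after) 0 ≤ d
edgeParentDepthsL-head≤ []           after≤ = after≤
edgeParentDepthsL-head≤ (node _ ∷ _) _      = ℕP.≤-refl

module DepthSequence (EP : List ℕ) where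

  G : ℕ → ℕ
  G = nthOr 0 EP

  Leaf : ℕ → Set
  Leaf i = i < length EP × G (suc i) ≤ G i

  -- The forest ts hangs from a vertex of depth d, and its edges are those at
  -- positions c, c + 1, … of the depth sequence EP.
  record ForestAt (d c : ℕ) (ts : List Tree) : Set where
    field
      before after : List ℕ
      splits       : EP ≡ before ++ edgeParentDepthsL d ts ++ after
      offset       : length before ≡ c
      closes       : nthOr 0 after 0 ≤ d

  module _ {d c ts} (ctx : ForestAt d c ts) where
    open ForestAt ctx

    forestAt-G : ∀ k → G (c + k) ≡ nthOr 0 (edgeParentDepthsL d ts ++ after) k
    forestAt-G k = begin
      nthOr 0 EP (c + k)                                             ≡⟨ cong₂ (λ l i → nthOr 0 l (i + k)) splits (sym offset) ⟩
      nthOr 0 (before ++ edgeParentDepthsL d ts ++ after) (length before + k) ≡⟨ nthOr-++ʳ before _ k ⟩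
      nthOr 0 (edgeParentDepthsL d ts ++ after) k                    ∎
      where open ≡-Reasoning

    forestAt-first : G c ≤ d
    forestAt-first = subst (_≤ d) (sym (trans (cong G (sym (ℕP.+-identityʳ c))) (forestAt-G 0)))
                           (edgeParentDepthsL-head≤ ts closes)

    forestAt-inside : ∀ {k} → k < edgesL ts → d ≤ G (c + k)
    forestAt-inside {k} k< = subst (d ≤_) (sym (trans (forestAt-G k) (nthOr-++ˡ (edgeParentDepthsL d ts) after k<′)))
                                   (nthOr-All _ (edgeParentDepthsL-≥ d ts) k<′)
      where
      k<′ : k < length (edgeParentDepthsL d ts)
      k<′ = subst (k <_) (sym (length-edgeParentDepthsL d ts)) k<

    forestAt-bound : c + edgesL ts ≤ length EP
    forestAt-bound = begin
      c + edgesL ts                                               ≡⟨ cong₂ _+_ (sym offset) (sym (length-edgeParentDepthsL d ts)) ⟩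
      length before + length (edgeParentDepthsL d ts)             ≤⟨ ℕP.+-monoʳ-≤ (length before) (LP.length-++-≤ˡ (edgeParentDepthsL d ts)) ⟩
      length before + length (edgeParentDepthsL d ts ++ after)    ≡⟨ sym (LP.length-++ before) ⟩
      length (before ++ edgeParentDepthsL d ts ++ after)          ≡⟨ cong length (sym splits) ⟩
      length EP                                                   ∎
      where open ℕP.≤-Reasoning

  module _ {d c cs ts} (ctx : ForestAt d c (node cs ∷ ts)) where
    open ForestAt ctx

    forestAt-stem : G c ≡ d
    forestAt-stem = trans (cong G (sym (ℕP.+-identityʳ c))) (forestAt-G ctx 0)

    forestAt-siblings : ForestAt d (suc c + edgesL cs) ts
    forestAt-siblings = record
      { before = before ++ d ∷ edgeParentDepthsL (suc d) cs
      ; after  = after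
      ; splits = trans splits (sym (trans (LP.++-assoc before (d ∷ edgeParentDepthsL (suc d) cs) _)
                   (cong (λ l → before ++ d ∷ l) (sym (LP.++-assoc (edgeParentDepthsL (suc d) cs) _ _)))))
      ; offset = trans (LP.length-++ before)
                   (trans (cong₂ (λ b e → b + suc e) offset (length-edgeParentDepthsL (suc d) cs)) (ℕP.+-suc c _))
      ; closes = closes
      }

    forestAt-children : ForestAt (suc d) (suc c) cs
    forestAt-children = record
      { before = before ++ d ∷ []
      ; after  = edgeParentDepthsL d ts ++ after
      ; splits = trans splits (sym (trans (LP.++-assoc before (d ∷ []) _)
                   (cong (λ l → before ++ d ∷ l) (sym (LP.++-assoc (edgeParentDepthsL (suc d) cs) _ _)))))
      ; offset = trans (LP.length-++ before) (trans (ℕP.+-comm _ 1) (cong suc offset))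
      ; closes = ℕP.m≤n⇒m≤1+n (edgeParentDepthsL-head≤ ts closes)
      }

  forestAt-root : ∀ ts → EP ≡ edgeParentDepthsL 0 ts → ForestAt 0 0 ts
  forestAt-root ts EP≡ = record
    { before = [] ; after = [] ; splits = trans EP≡ (sym (LP.++-identityʳ _)) ; offset = refl ; closes = z≤n }

  -- Edge c, whose parent has depth d, is the stem of the subtree with edges c, …, e - 1.
  record Span (d c e : ℕ) : Set where
    field
      stem    : G c ≡ d
      deeper  : ∀ k → c < k → k < e → d < G k
      closed  : G e ≤ d
      inRange : e ≤ length EP

  span : ∀ {d c cs ts} → ForestAt d c (node cs ∷ ts) → Span d c (suc c + edgesL cs)
  span {d} {c} {cs} ctx = record
    { stem    = forestAt-stem ctx
    ; deeper  = deeper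
    ; closed  = forestAt-first (forestAt-siblings ctx)
    ; inRange = ℕP.≤-trans (ℕP.m≤m+n _ _) (forestAt-bound (forestAt-siblings ctx))
    }
    where
    deeper : ∀ k → c < k → k < suc c + edgesL cs → d < G k
    deeper k c<k k< = subst (λ i → d < G i) (ℕP.m+[n∸m]≡n c<k)
                        (forestAt-inside (forestAt-children ctx) (ℕP.+-cancelˡ-< (suc c) _ _ k<′))
      where
      k<′ : suc c + (k ∸ suc c) < suc c + edgesL cs
      k<′ = subst (_< suc c + edgesL cs) (sym (ℕP.m+[n∸m]≡n c<k)) k<

  leafSpan : ∀ {d c ts} → ForestAt d c (node [] ∷ ts) → Span d c (suc c)
  leafSpan {c = c} ctx = subst (Span _ c) (ℕP.+-identityʳ (suc c)) (span ctx)

  span-leaf : ∀ {d c} → Span d c (suc c) → Leaf c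
  span-leaf s = Span.inRange s , subst (G (suc _) ≤_) (sym (Span.stem s)) (Span.closed s)

  span-≥ : ∀ {d c e j} → Span d c e → c ≤ j → j < e → d ≤ G j
  span-≥ s c≤j j<e with ℕP.m≤n⇒m<n∨m≡n c≤j
  ... | inj₁ c<j  = ℕP.<⇒≤ (Span.deeper s _ c<j j<e)
  ... | inj₂ refl = ℕP.≤-reflexive (sym (Span.stem s))

  mutual
    leafEdges-chain : ∀ {d c cs ts} → ForestAt d c (node cs ∷ ts) → Chain Leaf c (suc c + edgesL cs) (leafEdges c (node cs))
    leafEdges-chain {c = c} {cs = []}          ctx = cons ℕP.≤-refl (span-leaf (leafSpan ctx)) ([] (sym (ℕP.+-identityʳ (suc c))))
    leafEdges-chain {c = c} {cs = node _ ∷ _} ctx = chain-weaken (ℕP.n≤1+n c) (ℕP.m<m+n (suc c) (s≤s z≤n))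
                                                     (leafEdgesL-chain (forestAt-children ctx))

    leafEdgesL-chain : ∀ {d c ts} → ForestAt d c ts → Chain Leaf c (c + edgesL ts) (leafEdgesL c ts)
    leafEdgesL-chain {c = c} {ts = []}           ctx = [] (sym (ℕP.+-identityʳ c))
    leafEdgesL-chain {c = c} {ts = node cs ∷ ts} ctx =
      subst (λ e → Chain Leaf c e (leafEdgesL c (node cs ∷ ts))) (trans (ℕP.+-assoc (suc c) (edgesL cs) (edgesL ts)) (sym (ℕP.+-suc c _)))
            (chain-++ (leafEdges-chain ctx) (leafEdgesL-chain (forestAt-siblings ctx)))

  label : Maybe ℕ → ℤ
  label nothing  = -[1+ 0 ]
  label (just j) = + G j

  module Labelling
    (J  : ℕ → Maybe ℕ)
    (f  : ℕ → ℤ)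
    (f≡ : ∀ i → f i ≡ label (J i))
    (J-below  : ∀ {i j} → Leaf i → J i ≡ just j → j < i × StrictMinOn _<_ G j (suc i))
    (J-nested : ∀ {i l c} → Leaf i → i < l → Leaf l → J l ≡ just c → c ≤ i → ∃[ j ] J i ≡ just j × c ≤ j)
    where

    leaf-label< : ∀ {d c} → Span d c (suc c) → f c ℤ.< + d
    leaf-label< {c = c} s rewrite f≡ c with J c in e
    ... | nothing = ℤ.-<+
    ... | just j  with J-below (span-leaf s) e
    ...   | j<c , below = ℤ.+<+ (subst (G j <_) (Span.stem s) (below c j<c (ℕP.n≤1+n c)))

    lastLeaf-label≤ : ∀ {d c l} → Span d c (suc l) → Leaf l → f l ℤ.≤ + suc d ℤ.- + 2
    lastLeaf-label≤ {d} {l = l} s leaf rewrite f≡ l with J l in e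
    ... | nothing = bound-neg d
      where
      bound-neg : ∀ d → -[1+ 0 ] ℤ.≤ + suc d ℤ.- + 2
      bound-neg zero    = ℤP.≤-refl
      bound-neg (suc d) = ℤ.-≤+
    ... | just j with J-below leaf e
    ...   | j<l , below = bound-pos (ℕP.<-≤-trans (below (suc l) (ℕP.m≤n⇒m≤1+n j<l) ℕP.≤-refl) (Span.closed s))
      where
      bound-pos : ∀ {x d} → x < d → + x ℤ.≤ + suc d ℤ.- + 2
      bound-pos {d = suc d} (s≤s x≤d) = ℤ.+≤+ x≤d

    Cond3-labels : ∀ {d c e LI} → Span d c e → Chain Leaf c e LI → Cond3 d (map f LI)
    Cond3-labels {d} {c} {LI = LI} s chain xs y ys eq y≡d with map-≡-++-∷ f LI eq
    ... | L₁ , l , L₂ , refl , refl , refl with chain-split L₁ chain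
    ...   | earlier , c≤l , l<e , leaf-l with J l in e-l | f≡ l
    ...     | nothing | fl≡ = ⊥-elim (-1≢+ (trans (sym fl≡) y≡d))
      where
      -1≢+ : ∀ {n} → -[1+ 0 ] ≢ + n
      -1≢+ ()
    ...     | just j  | fl≡ with J-below leaf-l e-l
    ...       | j<l , below = AllP.map⁺ (All.map above earlier)
      where
      Gj≡d : G j ≡ d
      Gj≡d = ℤP.+-injective (trans (sym fl≡) y≡d)

      j≡c : j ≡ c
      j≡c with ℕP.<-cmp j c
      ... | tri< j<c _ _ = ⊥-elim (ℕP.<-irrefl (trans Gj≡d (sym (Span.stem s))) (below c j<c (ℕP.m≤n⇒m≤1+n c≤l)))
      ... | tri≈ _ j≡c _ = j≡c
      ... | tri> _ _ c<j = ⊥-elim (ℕP.<-irrefl (sym Gj≡d) (Span.deeper s j c<j (ℕP.<-trans j<l l<e)))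

      above : ∀ {i} → c ≤ i × i < l × Leaf i → + d ℤ.≤ f i
      above {i} (c≤i , i<l , leaf-i) with J-nested leaf-i i<l leaf-l (trans e-l (cong just j≡c)) c≤i
      ... | j′ , e-i , c≤j′ = subst (+ d ℤ.≤_) (sym (trans (f≡ i) (cong label e-i)))
                                (ℤ.+≤+ (span-≥ s c≤j′ (ℕP.<-trans (proj₁ (J-below leaf-i e-i)) (ℕP.<-trans i<l l<e))))

    mutual
      decorated-SubOK : ∀ {d c cs ts} → ForestAt d c (node cs ∷ ts) → SubOK d (decorated f c (node cs))
      decorated-SubOK {cs = []} ctx = leaf-label< (leafSpan ctx) , Cond3-labels (span ctx) (leafEdges-chain ctx)
      decorated-SubOK {d} {c} {cs = node cs′ ∷ ts′} ctx =
        subst (Any _) (sym leaves≡) (AnyP.map⁺ (Any.map last-bound (chain-last c<e chain))) ,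
        subst (Cond3 d) (sym leaves≡) (Cond3-labels (span ctx) chain) ,
        decoratedL-SubsOK (forestAt-children ctx)
        where
        cs = node cs′ ∷ ts′
        chain : Chain Leaf c (suc c + edgesL cs) (leafEdges c (node cs))
        chain = leafEdges-chain ctx
        leaves≡ : leavesL (decoratedL f (suc c) cs) ≡ map f (leafEdgesL (suc c) cs)
        leaves≡ = leavesL-decoratedL f (suc c) cs
        c<e : c < suc c + edgesL cs
        c<e = s≤s (ℕP.m≤m+n c _)
        last-bound : ∀ {l} → suc l ≡ suc c + edgesL cs × Leaf l → f l ℤ.≤ + suc d ℤ.- + 2
        last-bound (refl , leaf) = lastLeaf-label≤ (span ctx) leaf

      decoratedL-SubsOK : ∀ {d c ts} → ForestAt d c ts → SubsOK d (decoratedL f c ts)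
      decoratedL-SubsOK {ts = []}          _   = tt
      decoratedL-SubsOK {ts = node _ ∷ _} ctx = decorated-SubOK ctx , decoratedL-SubsOK (forestAt-siblings ctx)

-- Synchronized intervals

module Synchronized {n P ts} (dyckP : DyckPath n P) (dyckQ : DyckPath n (contourL ts))
                    (P≤Q : P ≤T contourL ts) (sameType : Type P ≡ Type (contourL ts)) where

  open DepthSequence (edgeParentDepthsL 0 ts) public
  module P = DyckProfile dyckP
  module Q = DyckProfile dyckQ

  HQ≡G : ∀ a → Q.H a ≡ G a
  HQ≡G a = cong ℤ.∣_∣ (profile-contourL ts a)

  length-depths : length (edgeParentDepthsL 0 ts) ≡ n
  length-depths = begin
    length (edgeParentDepthsL 0 ts)          ≡⟨ sym (LP.length-map +_ (edgeParentDepthsL 0 ts)) ⟩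
    length (map +_ (edgeParentDepthsL 0 ts)) ≡⟨ cong length (sym (upHeights-contourL 0 ts)) ⟩
    length (upHeights (+ 0) (contourL ts))   ≡⟨ length-upHeights (+ 0) (contourL ts) ⟩
    countU (contourL ts)                     ≡⟨ proj₁ dyckQ ⟩
    n                                        ∎
    where open ≡-Reasoning

  leaf-index : ∀ {i} → Leaf i → i < countU P
  leaf-index (i< , _) = subst (_ <_) (trans length-depths (sym (proj₁ dyckP))) i<

  same-upUp : ∀ {i} → i < n ∸ 1 → does (P.H (suc i) ℕP.≟ suc (P.H i)) ≡ does (Q.H (suc i) ℕP.≟ suc (Q.H i))
  same-upUp {i} i< = letter-injective (MaybeP.just-injective (begin
    just (letter (does (P.H (suc i) ℕP.≟ suc (P.H i))))  ≡⟨ sym (P.Type-letter (subst (λ m → i < m ∸ 1) (sym (proj₁ dyckP)) i<)) ⟩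
    nth (Type P) i                                       ≡⟨ cong (λ t → nth t i) sameType ⟩
    nth (Type (contourL ts)) i                                       ≡⟨ Q.Type-letter (subst (λ m → i < m ∸ 1) (sym (proj₁ dyckQ)) i<) ⟩
    just (letter (does (Q.H (suc i) ℕP.≟ suc (Q.H i))))  ∎))
    where open ≡-Reasoning

  -- A leaf edge of T is an up step of Q followed by a down step; equal types
  -- transfer this to P, except for the last up step, which is followed by a
  -- down step in every Dyck path.
  leaf-flat : ∀ {i} → Leaf i → ¬ P.UpUp i
  leaf-flat {i} (i< , G≤) upP with ℕP.m≤n⇒m<n∨m≡n (subst (i <_) length-depths i<)
  ... | inj₂ si≡n = ℕP.0≢1+n (trans (sym P.H-end) (trans (cong P.H (trans (proj₁ dyckP) (sym si≡n))) upP))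
  ... | inj₁ si<n = true≢false (trans (sym (dec-true (P.H (suc i) ℕP.≟ suc (P.H i)) upP))
                                (trans (same-upUp (ℕP.∸-monoˡ-≤ 1 si<n)) (dec-false (Q.H (suc i) ℕP.≟ suc (Q.H i)) ¬upQ)))
    where
    true≢false : true ≢ false
    true≢false ()
    ¬upQ : ¬ Q.UpUp i
    ¬upQ upQ = ℕP.<-irrefl refl (subst (_≤ G i) (trans (sym (HQ≡G (suc i))) (trans upQ (cong suc (HQ≡G i)))) G≤)

  strictMin-transfer : ∀ {a b} → StrictMinOn _<_ P.H a b → StrictMinOn _<_ G a b
  strictMin-transfer {a} {b} below c a<c c≤b =
    ℤP.drop‿+<+ (subst₂ ℤ._<_ (profile-contourL ts a) (profile-contourL ts c) (profile-tamari P≤Q belowP c a<c c≤b))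
    where
    belowP : StrictMinOn ℤ._<_ (profile P) a b
    belowP c a<c c≤b = subst₂ ℤ._<_ (sym (P.profile≡H a)) (sym (P.profile≡H c)) (ℤ.+<+ (below c a<c c≤b))

  ray-below : ∀ {i j} → Leaf i → rayIndex P i ≡ just j → j < i × StrictMinOn _<_ G j (suc i)
  ray-below leaf e with P.ray-strictMin (leaf-flat leaf) (trans (sym (P.rayIndex≡ray (leaf-index leaf))) e)
  ... | j<i , below = j<i , strictMin-transfer below

  ray-nested : ∀ {i l c} → Leaf i → i < l → Leaf l → rayIndex P l ≡ just c → c ≤ i →
               ∃[ j ] rayIndex P i ≡ just j × c ≤ j
  ray-nested leaf-i i<l leaf-l e c≤i
    with P.ray-nested (leaf-flat leaf-i) i<l (leaf-flat leaf-l) (trans (sym (P.rayIndex≡ray (leaf-index leaf-l))) e) c≤i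
  ... | j , e′ , c≤j = j , trans (P.rayIndex≡ray (leaf-index leaf-i)) e′ , c≤j

  labelR≡label : ∀ i → labelR P (node ts) i ≡ label (rayIndex P i)
  labelR≡label i with rayIndex P i
  ... | nothing = refl
  ... | just j  = cong +_ (nthℕ≡nthOr (edgeParentDepthsL 0 ts) j)

  open Labelling (rayIndex P) (labelR P (node ts)) labelR≡label ray-below ray-nested public

proposition8 : (n : ℕ) (P Q : Word) → 1 ≤ n → SynchronizedInterval n P Q →
                 (T : Tree) → contour T ≡ Q → DecoratedTree (R P T)
proposition8 n P .(contour (node ts)) _ (dyckP , dyckQ , P≤Q , sameType) (node ts) refl =
  subst DecoratedTree (sym (decorate≡ (labelR P (node ts)) ts)) (decoratedL-SubsOK (forestAt-root ts refl))
  where open Synchronized {ts = ts} dyckP dyckQ P≤Q sameType
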